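{- Let $A_1\le A_2\le\cdots\le A_p$ and $B_1\le B_2\le\cdots\le B_q$ be real numbers, and let $1\le k\le pq$. Order the triples $(A_i+B_j,\,i,\,j)$, $1\le i\le p$, $1\le j\le q$, lexicographically, and let $S$ be the set of the $k$ smallest triples in this order (the minimal $k$ values of the form $A_i+B_j$). Let $a=|\{i : (A_i+B_j,i,j)\in S \text{ for some } j\}|$ be the number of terms of $A$ required to produce these $k$ values and $b=|\{j : (A_i+B_j,i,j)\in S \text{ for some } i\}|$ the number of terms of $B$ required. Then $a+b-1\le k$. -}

module Defs where

open import Level using (Level; suc; _⊔_)
open import Data.Nat using (ℕ)
open import Data.Fin using (Fin)
import Data.Fin as F
open import Data.Bool using (Bool)
open import Data.Vec using (tabulate; sum)
open import Data.Fin.Subset using (∣_∣)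
open import Data.Product using (_×_)
open import Data.Sum using (_⊎_)
open import Relation.Nullary using (¬_)
open import Relation.Binary.PropositionalEquality using (_≡_)
open import Relation.Binary.Structures using (IsTotalOrder)
open import Algebra.Bundles using (AbelianGroup)

-- A totally ordered abelian group (the real numbers with + and ≤ are an
-- instance); written additively.
record TotallyOrderedAbelianGroup (c ℓ₁ ℓ₂ : Level) : Set (Level.suc (c ⊔ ℓ₁ ⊔ ℓ₂)) where
  field
    abelianGroup : AbelianGroup c ℓ₁
  open AbelianGroup abelianGroup public
  field
    _≤_          : Carrier → Carrier → Set ℓ₂
    isTotalOrder : IsTotalOrder _≈_ _≤_
    ≤-+-mono     : ∀ {x y} z → x ≤ y → (x ∙ z) ≤ (y ∙ z)

  _+_ : Carrier → Carrier → Carrier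
  _+_ = _∙_

  _<_ : Carrier → Carrier → Set (ℓ₁ ⊔ ℓ₂)
  x < y = (x ≤ y) × ¬ (x ≈ y)

module _ {c ℓ₁ ℓ₂} (G : TotallyOrderedAbelianGroup c ℓ₁ ℓ₂) where
  open TotallyOrderedAbelianGroup G

  LexLt : ∀ {p q} → Carrier → Fin p → Fin q → Carrier → Fin p → Fin q → Set (ℓ₁ ⊔ ℓ₂)
  LexLt x i j x' i' j' =
    (x < x') ⊎ ((x ≈ x') × ((i F.< i') ⊎ ((i ≡ i') × (j F.< j'))))

pairCount : ∀ {p q} → (Fin p → Fin q → Bool) → ℕ
pairCount S = sum (tabulate (λ i → ∣ tabulate (S i) ∣))

module Submission where

-- Because A and B are sorted, A i' + B j' ≤ A i + B j whenever
-- i' ≤ i and j' ≤ j, and then the triple (i', j') cannot come after (i, j);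
-- hence S is a down-set of the grid Fin p × Fin q.  In particular every row i
-- that meets S contains (i, 0) and every column j that meets S contains (0, j),
-- so  a ≤ |column 0 of S|  and  b ≤ |row 0 of S|.  Row 0 and column 0 share
-- only the cell (0, 0), so together they hold at most 1 + |S| = 1 + k cells,
-- giving a + b - 1 ≤ k.

open import Defs
open import Data.Nat using (ℕ; _+_; _∸_; _≤_; _*_)
open import Data.Fin using (Fin)
import Data.Fin as F
open import Data.Bool using (Bool; T; not; true; false)
open import Data.Fin.Subset using (Subset; _∈_; ∣_∣; _⊆_)
open import Data.Product using (∃)
open import Relation.Binary.PropositionalEquality using (_≡_)
open import Function.Bundles using (_⇔_)

import Data.Nat as ℕ
open import Data.Nat.Properties
  using (≤-refl; ≤-trans; ≤-reflexive; +-mono-≤; +-monoˡ-≤; +-comm; m≤n+o⇒m∸n≤o;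
         n≤1+n; m≤n+m; *-zeroʳ; <⇒≱)
open import Data.Fin.Subset.Properties using (p⊆q⇒∣p∣≤∣q∣; x∈p⇒∣p-x∣<∣p∣)
open import Data.Vec using (tabulate; _∷_)
open import Data.Vec.Properties using (lookup∘tabulate; lookup⇒[]=)
open import Data.Bool.Properties using (T-≡; T-not-≡)
open import Data.Product using (_,_)
open import Data.Sum using (inj₁; inj₂)
open import Data.Unit using (tt)
open import Relation.Nullary using (¬_)
open import Relation.Binary.PropositionalEquality using (refl; trans)
open import Relation.Binary.Structures using (IsTotalOrder)
open import Function.Bundles using (Equivalence)

∈-tabulate : ∀ {n} (f : Fin n → Bool) {j} → T (f j) → j ∈ tabulate f
∈-tabulate f {j} fj =
  lookup⇒[]= j (tabulate f) (trans (lookup∘tabulate f j) (Equivalence.to T-≡ fj))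

column≤pairCount : ∀ {p q} (S : Fin p → Fin q → Bool) (j : Fin q) →
                   ∣ tabulate (λ i → S i j) ∣ ≤ pairCount S
column≤pairCount {ℕ.zero}  S j = ℕ.z≤n
column≤pairCount {ℕ.suc p} S j with S F.zero j in S₀ⱼ
... | false = ≤-trans (column≤pairCount (λ i → S (F.suc i)) j)
                      (m≤n+m _ ∣ tabulate (S F.zero) ∣)
... | true  = +-mono-≤ row₀-nonempty (column≤pairCount (λ i → S (F.suc i)) j)
  where
  -- the cell (0, j) lies in S, so row 0 is nonempty
  row₀-nonempty : 1 ≤ ∣ tabulate (S F.zero) ∣
  row₀-nonempty = ≤-trans (ℕ.s≤s ℕ.z≤n)
    (x∈p⇒∣p-x∣<∣p∣ (∈-tabulate (S F.zero) (Equivalence.from T-≡ S₀ⱼ)))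

column₀-tail+row₀≤pairCount :
  ∀ {p q} (S : Fin (ℕ.suc p) → Fin q → Bool) (j : Fin q) →
  ∣ tabulate (λ i → S (F.suc i) j) ∣ + ∣ tabulate (S F.zero) ∣ ≤ pairCount S
column₀-tail+row₀≤pairCount S j = ≤-trans
  (+-monoˡ-≤ ∣ tabulate (S F.zero) ∣ (column≤pairCount (λ i → S (F.suc i)) j))
  (≤-reflexive (+-comm (pairCount (λ i → S (F.suc i))) ∣ tabulate (S F.zero) ∣))

∣x∷p∣≤1+∣p∣ : ∀ {n} x (p : Subset n) → ∣ x ∷ p ∣ ≤ 1 + ∣ p ∣
∣x∷p∣≤1+∣p∣ false p = n≤1+n ∣ p ∣
∣x∷p∣≤1+∣p∣ true  p = ≤-refl

-- Row 0 and column 0 overlap only in the corner cell, so together they hold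
-- at most one cell more than the whole matrix.
corner-count : ∀ {p q} (S : Fin (ℕ.suc p) → Fin (ℕ.suc q) → Bool) →
               ∣ tabulate (λ i → S i F.zero) ∣ + ∣ tabulate (S F.zero) ∣
                 ≤ 1 + pairCount S
corner-count S = ≤-trans
  (+-monoˡ-≤ ∣ tabulate (S F.zero) ∣
     (∣x∷p∣≤1+∣p∣ (S F.zero F.zero) (tabulate (λ i → S (F.suc i) F.zero))))
  (ℕ.s≤s (column₀-tail+row₀≤pairCount S F.zero))

module _ {c ℓ₁ ℓ₂} (G : TotallyOrderedAbelianGroup c ℓ₁ ℓ₂) where
  open TotallyOrderedAbelianGroup G
    using (Carrier; isTotalOrder; ≤-+-mono; comm)
    renaming (_≤_ to _≼_; _+_ to _⊕_)
  open IsTotalOrder isTotalOrder using (antisym; ≲-respˡ-≈; ≲-respʳ-≈)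
    renaming (trans to ≼-trans)

  -- Addition is monotone in both arguments (the axiom gives the left one;
  -- commutativity transfers it to the right).
  ⊕-mono : ∀ {a a' b b'} → a ≼ a' → b ≼ b' → (a ⊕ b) ≼ (a' ⊕ b')
  ⊕-mono {a} {a'} {b} {b'} a≼a' b≼b' = ≼-trans (≤-+-mono b a≼a') a'⊕b≼a'⊕b'
    where
    a'⊕b≼a'⊕b' : (a' ⊕ b) ≼ (a' ⊕ b')
    a'⊕b≼a'⊕b' = ≲-respʳ-≈ (comm b' a') (≲-respˡ-≈ (comm b a') (≤-+-mono a' b≼b'))

  ¬LexLt-dominated : ∀ {p q} {x y : Carrier} {i i' : Fin p} {j j' : Fin q} →
                     y ≼ x → i' F.≤ i → j' F.≤ j → ¬ LexLt G x i j y i' j'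
  ¬LexLt-dominated y≼x i'≤i j'≤j (inj₁ (x≼y , x≉y))         = x≉y (antisym x≼y y≼x)
  ¬LexLt-dominated y≼x i'≤i j'≤j (inj₂ (_ , inj₁ i<i'))       = <⇒≱ i<i' i'≤i
  ¬LexLt-dominated y≼x i'≤i j'≤j (inj₂ (_ , inj₂ (_ , j<j'))) = <⇒≱ j<j' j'≤j

  initial-segment-down-closed :
    ∀ {p q} (A : Fin p → Carrier) (B : Fin q → Carrier) →
    (∀ i i' → i F.≤ i' → A i ≼ A i') →
    (∀ j j' → j F.≤ j' → B j ≼ B j') →
    (S : Fin p → Fin q → Bool) →
    (∀ i j i' j' → T (S i j) → T (not (S i' j')) →
       LexLt G (A i ⊕ B j) i j (A i' ⊕ B j') i' j') →
    ∀ {i j i' j'} → i' F.≤ i → j' F.≤ j → T (S i j) → T (S i' j')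
  initial-segment-down-closed A B sortedA sortedB S before {i} {j} {i'} {j'}
                              i'≤i j'≤j Sij with S i' j' in Si'j'
  ... | true  = tt
  ... | false = ¬LexLt-dominated
                  (⊕-mono (sortedA i' i i'≤i) (sortedB j' j j'≤j)) i'≤i j'≤j
                  (before i j i' j' Sij (Equivalence.from T-not-≡ Si'j'))

lemma1 : ∀ {c ℓ₁ ℓ₂} (G : TotallyOrderedAbelianGroup c ℓ₁ ℓ₂) (p q k : ℕ)
  (A : Fin p → TotallyOrderedAbelianGroup.Carrier G)
  (B : Fin q → TotallyOrderedAbelianGroup.Carrier G) →
  (∀ i i' → i F.≤ i' → TotallyOrderedAbelianGroup._≤_ G (A i) (A i')) →
  (∀ j j' → j F.≤ j' → TotallyOrderedAbelianGroup._≤_ G (B j) (B j')) →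
  1 ≤ k → k ≤ p * q →
  (S : Fin p → Fin q → Bool) →
  pairCount S ≡ k →
  (∀ i j i' j' → T (S i j) → T (not (S i' j')) →
    LexLt G (TotallyOrderedAbelianGroup._+_ G (A i) (B j)) i j
            (TotallyOrderedAbelianGroup._+_ G (A i') (B j')) i' j') →
  (I : Subset p) → (∀ i → (i ∈ I) ⇔ ∃ (λ j → T (S i j))) →
  (J : Subset q) → (∀ j → (j ∈ J) ⇔ ∃ (λ i → T (S i j))) →
  ∣ I ∣ + ∣ J ∣ ∸ 1 ≤ k
-- an empty grid has no room for k ≥ 1 cells
lemma1 G ℕ.zero q k A B _ _ (ℕ.s≤s _) () S _ _ I _ J _
lemma1 G (ℕ.suc p) ℕ.zero k A B _ _ 1≤k k≤p*0 S _ _ I _ J _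
  with ≤-trans 1≤k (≤-trans k≤p*0 (≤-reflexive (*-zeroʳ (ℕ.suc p))))
... | ()
lemma1 G (ℕ.suc p) (ℕ.suc q) k A B sortedA sortedB _ _ S refl before I I-rows J J-cols =
  m≤n+o⇒m∸n≤o (∣ I ∣ + ∣ J ∣) 1
    (≤-trans (+-mono-≤ (p⊆q⇒∣p∣≤∣q∣ I⊆column₀) (p⊆q⇒∣p∣≤∣q∣ J⊆row₀)) (corner-count S))
  where
  down-closed : ∀ {i j i' j'} → i' F.≤ i → j' F.≤ j → T (S i j) → T (S i' j')
  down-closed = initial-segment-down-closed G A B sortedA sortedB S before
  I⊆column₀ : I ⊆ tabulate (λ i → S i F.zero)
  I⊆column₀ {i} i∈I with Equivalence.to (I-rows i) i∈I
  ... | j , Sij = ∈-tabulate (λ i → S i F.zero) (down-closed ≤-refl ℕ.z≤n Sij)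
  J⊆row₀ : J ⊆ tabulate (S F.zero)
  J⊆row₀ {j} j∈J with Equivalence.to (J-cols j) j∈J
  ... | i , Sij = ∈-tabulate (S F.zero) (down-closed ℕ.z≤n ≤-refl Sij)
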